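{- Let $n\ge 1$, $s\ge 2$ and $q$ be integers, let $\mathcal F\subset 2^{[n]}$ have property $D(s,q)$, and let $1\le i<j\le n$. Then $S_{i,j}(\mathcal F)$ also has property $D(s,q)$.
   Context: A family $\mathcal F\subset 2^{[n]}$ has property $D(s,q)$ if $|F_1\cup\dots\cup F_s|>q$ for all $F_1,\dots,F_s\in\mathcal F$ that are pairwise disjoint ($F_a\cap F_b=\emptyset$ for $a\ne b$; members may coincide only if empty). For $i<j$ and $A\subset[n]$, $S_{i,j}(A)=(A\setminus\{j\})\cup\{i\}$ if $j\in A$ and $i\notin A$, and $S_{i,j}(A)=A$ otherwise; $S_{i,j}(\mathcal F)=\{S_{i,j}(A):A\in\mathcal F\}\cup\{A: A\in\mathcal F,\ S_{i,j}(A)\in\mathcal F\}$. -}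

module Defs where

open import Data.Nat using (ℕ; zero; suc)
open import Data.Integer using (ℤ; +_; _<_)
open import Data.Fin using (Fin)
open import Data.Fin.Subset using (Subset; inside; outside; _∈_; _∉_; _∩_; _∪_; ⊥; ⋃; ∣_∣)
open import Data.Fin.Subset.Properties using (_∈?_)
open import Data.List using (map)
open import Data.List.Base using (allFin)
open import Data.Vec using (_[_]≔_)
open import Data.Product using (Σ; _×_)
open import Data.Sum using (_⊎_)
open import Relation.Binary.PropositionalEquality using (_≡_)
open import Relation.Nullary using (¬_; yes; no)

Family : ℕ → Set₁
Family n = Subset n → Set

⋃ᶠ : ∀ {n s} → (Fin s → Subset n) → Subset n
⋃ᶠ {s = s} G = ⋃ (map G (allFin s))

D : ∀ {n} → ℕ → ℤ → Family n → Set
D {n} s q 𝓕 =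
  (G : Fin s → Subset n) →
  (∀ a → 𝓕 (G a)) →
  (∀ a b → ¬ (a ≡ b) → G a ∩ G b ≡ ⊥) →
  q < + ∣ ⋃ᶠ G ∣

shift : ∀ {n} → Fin n → Fin n → Subset n → Subset n
shift i j A with j ∈? A | i ∈? A
... | yes _ | no _ = (A [ j ]≔ outside) [ i ]≔ inside
... | _     | _    = A

shiftFam : ∀ {n} → Fin n → Fin n → Family n → Family n
shiftFam i j 𝓕 A = (Σ (Subset _) λ B → 𝓕 B × shift i j B ≡ A) ⊎ (𝓕 A × 𝓕 (shift i j A))

module Submission where

-- Let σ be the transposition of i and j acting on subsets; on a set containing j
-- but not i, the shift S_{i,j} acts as σ, and it fixes every other set.  A member
-- X of S_{i,j}(𝓕) is therefore either "kept" (X ∈ 𝓕, and σ X ∈ 𝓕 whenever j ∈ X,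
-- i ∉ X) or "moved" (i ∈ X, j ∉ X and σ X ∈ 𝓕).  Take s pairwise disjoint
-- members of S_{i,j}(𝓕).  If all are kept, they lie in 𝓕 and D(s,q) for 𝓕
-- applies.  If one is moved, it contains i, so no other member does; a kept member
-- avoiding i either contains j (so σ maps it into 𝓕) or avoids j (so σ fixes it).
-- Hence σ maps every member into 𝓕, and since relabelling along a permutation
-- preserves disjointness and the size of unions, D(s,q) for 𝓕 applies to the
-- σ-images.

open import Defs
open import Data.Nat using (ℕ; _≤_)
open import Data.Integer using (ℤ)
open import Data.Fin using (Fin) renaming (_<_ to _<ᶠ_)

open import Data.Nat using (zero; suc)
open import Data.Nat.Properties using (+-0-commutativeMonoid)
open import Data.Integer using (+_; _<_)
open import Data.Fin using (zero; suc)
open import Data.Fin.Properties using (_≟_; <⇒≢)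
open import Data.Fin.Permutation using (Permutation; _⟨$⟩ʳ_; transpose)
import Data.Fin.Permutation.Components as Components
open import Data.Fin.Subset using (Subset; inside; outside; _∈_; _∉_; _∩_; ⊥; ⋃; ∣_∣)
open import Data.Fin.Subset.Properties using (_∈?_; x∈p∩q⁺; ∉⊥)
open import Data.Bool using (Bool; true; false)
open import Data.Vec using ([]; _∷_; lookup; tabulate; zipWith; _[_]≔_)
open import Data.Vec.Properties
  using (tabulate∘lookup; tabulate-cong; lookup∘tabulate; lookup-zipWith; lookup-replicate;
         lookup∘update; lookup∘update′; []=⇒lookup; lookup⇒[]=)
open import Data.List using (List; []; _∷_; map)
open import Data.List.Base using (allFin)
open import Data.List.Properties using (map-∘)
open import Data.Product using (_×_; _,_; proj₁; ∃)
open import Data.Sum using (_⊎_; inj₁; inj₂)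
open import Function using (_∘_)
open import Relation.Binary.PropositionalEquality
open import Relation.Nullary using (¬_; Dec; yes; no; contradiction; ¬?; _×-dec_)
open import Algebra.Properties.CommutativeMonoid.Sum +-0-commutativeMonoid
  using (sum; sum-cong-≗; sum-permute)

open ≡-Reasoning

subset-ext : ∀ {n} {A B : Subset n} → (∀ x → lookup A x ≡ lookup B x) → A ≡ B
subset-ext {A = A} {B} same = begin
  A                   ≡⟨ tabulate∘lookup A ⟨
  tabulate (lookup A) ≡⟨ tabulate-cong same ⟩
  tabulate (lookup B) ≡⟨ tabulate∘lookup B ⟩
  B                   ∎

∈⇒inside : ∀ {n} {x : Fin n} {A} → x ∈ A → lookup A x ≡ inside
∈⇒inside = []=⇒lookup

∉⇒outside : ∀ {n} {x : Fin n} {A} → x ∉ A → lookup A x ≡ outside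
∉⇒outside {x = x} {A} x∉A with lookup A x in eq
... | true  = contradiction (lookup⇒[]= x A eq) x∉A
... | false = refl

disjoint⇒∉ : ∀ {n} {x : Fin n} {A B} → A ∩ B ≡ ⊥ → x ∈ A → x ∉ B
disjoint⇒∉ A∩B≡⊥ x∈A x∈B = ∉⊥ (subst (_ ∈_) A∩B≡⊥ (x∈p∩q⁺ (x∈A , x∈B)))

-- Size as a sum of indicator values; this lets us reuse invariance of finite
-- sums under permutations.
indicator : Bool → ℕ
indicator true  = 1
indicator false = 0

∣∣-as-sum : ∀ {n} (A : Subset n) → ∣ A ∣ ≡ sum (indicator ∘ lookup A)
∣∣-as-sum []          = refl
∣∣-as-sum (true  ∷ A) = cong suc (∣∣-as-sum A)
∣∣-as-sum (false ∷ A) = ∣∣-as-sum A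

relabel : ∀ {n} → Permutation n n → Subset n → Subset n
relabel π A = tabulate (λ x → lookup A (π ⟨$⟩ʳ x))

lookup-relabel : ∀ {n} (π : Permutation n n) A x → lookup (relabel π A) x ≡ lookup A (π ⟨$⟩ʳ x)
lookup-relabel π A = lookup∘tabulate _

relabel-involutive : ∀ {n} (π : Permutation n n) → (∀ x → π ⟨$⟩ʳ (π ⟨$⟩ʳ x) ≡ x) →
  ∀ A → relabel π (relabel π A) ≡ A
relabel-involutive π π²≡id A = subset-ext λ x → begin
  lookup (relabel π (relabel π A)) x ≡⟨ lookup-relabel π (relabel π A) x ⟩
  lookup (relabel π A) (π ⟨$⟩ʳ x)    ≡⟨ lookup-relabel π A _ ⟩
  lookup A (π ⟨$⟩ʳ (π ⟨$⟩ʳ x))       ≡⟨ cong (lookup A) (π²≡id x) ⟩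
  lookup A x                        ∎

relabel-zipWith : ∀ {n} (π : Permutation n n) (f : Bool → Bool → Bool) A B →
  relabel π (zipWith f A B) ≡ zipWith f (relabel π A) (relabel π B)
relabel-zipWith π f A B = subset-ext λ x → begin
  lookup (relabel π (zipWith f A B)) x            ≡⟨ lookup-relabel π (zipWith f A B) x ⟩
  lookup (zipWith f A B) (π ⟨$⟩ʳ x)               ≡⟨ lookup-zipWith f _ A B ⟩
  f (lookup A (π ⟨$⟩ʳ x)) (lookup B (π ⟨$⟩ʳ x))   ≡⟨ cong₂ f (lookup-relabel π A x) (lookup-relabel π B x) ⟨
  f (lookup (relabel π A) x) (lookup (relabel π B) x) ≡⟨ lookup-zipWith f x (relabel π A) (relabel π B) ⟨
  lookup (zipWith f (relabel π A) (relabel π B)) x ∎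

relabel-⊥ : ∀ {n} (π : Permutation n n) → relabel π ⊥ ≡ ⊥
relabel-⊥ π = subset-ext λ x → begin
  lookup (relabel π ⊥) x    ≡⟨ lookup-relabel π ⊥ x ⟩
  lookup ⊥ (π ⟨$⟩ʳ x)       ≡⟨ lookup-replicate (π ⟨$⟩ʳ x) outside ⟩
  outside                   ≡⟨ lookup-replicate x outside ⟨
  lookup ⊥ x                ∎

relabel-⋃ : ∀ {n} (π : Permutation n n) (L : List (Subset n)) → ⋃ (map (relabel π) L) ≡ relabel π (⋃ L)
relabel-⋃ π []      = sym (relabel-⊥ π)
relabel-⋃ π (A ∷ L) = trans (cong (zipWith _ (relabel π A)) (relabel-⋃ π L))
                            (sym (relabel-zipWith π _ A (⋃ L)))

relabel-∣∣ : ∀ {n} (π : Permutation n n) A → ∣ relabel π A ∣ ≡ ∣ A ∣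
relabel-∣∣ π A = begin
  ∣ relabel π A ∣                          ≡⟨ ∣∣-as-sum (relabel π A) ⟩
  sum (indicator ∘ lookup (relabel π A))   ≡⟨ sum-cong-≗ (cong indicator ∘ lookup-relabel π A) ⟩
  sum (indicator ∘ lookup A ∘ (π ⟨$⟩ʳ_))   ≡⟨ sum-permute (indicator ∘ lookup A) π ⟨
  sum (indicator ∘ lookup A)               ≡⟨ ∣∣-as-sum A ⟨
  ∣ A ∣                                    ∎

relabel-D : ∀ {n s q} (π : Permutation n n) (𝓕 : Family n) → D s q 𝓕 → D s q (𝓕 ∘ relabel π)
relabel-D {s = s} {q} π 𝓕 D𝓕 G member disjoint =
  subst (λ m → q < + m) sameSize (D𝓕 (relabel π ∘ G) member relabelledDisjoint)
  where
  relabelledDisjoint : ∀ a b → ¬ a ≡ b → relabel π (G a) ∩ relabel π (G b) ≡ ⊥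
  relabelledDisjoint a b a≢b = begin
    relabel π (G a) ∩ relabel π (G b) ≡⟨ relabel-zipWith π _ (G a) (G b) ⟨
    relabel π (G a ∩ G b)             ≡⟨ cong (relabel π) (disjoint a b a≢b) ⟩
    relabel π ⊥                       ≡⟨ relabel-⊥ π ⟩
    ⊥                                 ∎

  sameSize : ∣ ⋃ᶠ (relabel π ∘ G) ∣ ≡ ∣ ⋃ᶠ G ∣
  sameSize = begin
    ∣ ⋃ (map (relabel π ∘ G) (allFin s)) ∣         ≡⟨ cong (∣_∣ ∘ ⋃) (map-∘ (allFin s)) ⟩
    ∣ ⋃ (map (relabel π) (map G (allFin s))) ∣     ≡⟨ cong ∣_∣ (relabel-⋃ π (map G (allFin s))) ⟩
    ∣ relabel π (⋃ᶠ G) ∣                           ≡⟨ relabel-∣∣ π (⋃ᶠ G) ⟩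
    ∣ ⋃ᶠ G ∣                                        ∎

allOrSome : ∀ {s} {P Q : Fin s → Set} → (∀ a → P a ⊎ Q a) → (∀ a → P a) ⊎ ∃ Q
allOrSome {zero}  choice = inj₁ λ ()
allOrSome {suc s} choice with choice zero | allOrSome (choice ∘ suc)
... | inj₂ q₀ | _              = inj₂ (zero , q₀)
... | inj₁ _  | inj₂ (a , q)   = inj₂ (suc a , q)
... | inj₁ p₀ | inj₁ ps        = inj₁ λ { zero → p₀ ; (suc a) → ps a }

data Position {n} (i j : Fin n) : Fin n → Set where
  at-i      : Position i j i
  at-j      : Position i j j
  elsewhere : ∀ {x} → x ≢ i → x ≢ j → Position i j x

position : ∀ {n} (i j x : Fin n) → Position i j x
position i j x with x ≟ i | x ≟ j
... | yes refl | _        = at-i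
... | no _     | yes refl = at-j
... | no x≢i   | no x≢j   = elsewhere x≢i x≢j

module Swap {n} (i j : Fin n) where

  τ : Fin n → Fin n
  τ = Components.transpose i j

  τ-at-i : τ i ≡ j
  τ-at-i with i ≟ i
  ... | yes _   = refl
  ... | no i≢i  = contradiction refl i≢i

  τ-at-j : τ j ≡ i
  τ-at-j with j ≟ i
  ... | yes j≡i = j≡i
  ... | no _ with j ≟ j
  ...   | yes _  = refl
  ...   | no j≢j = contradiction refl j≢j

  τ-elsewhere : ∀ {x} → x ≢ i → x ≢ j → τ x ≡ x
  τ-elsewhere {x} x≢i x≢j with x ≟ i
  ... | yes x≡i = contradiction x≡i x≢i
  ... | no _ with x ≟ j
  ...   | yes x≡j = contradiction x≡j x≢j
  ...   | no _    = refl

  τ-involutive : ∀ x → τ (τ x) ≡ x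
  τ-involutive x with position i j x
  ... | at-i              = trans (cong τ τ-at-i) τ-at-j
  ... | at-j              = trans (cong τ τ-at-j) τ-at-i
  ... | elsewhere x≢i x≢j = trans (cong τ (τ-elsewhere x≢i x≢j)) (τ-elsewhere x≢i x≢j)

  σ : Subset n → Subset n
  σ = relabel (transpose i j)

  σ-at-i : ∀ A → lookup (σ A) i ≡ lookup A j
  σ-at-i A = trans (lookup-relabel (transpose i j) A i) (cong (lookup A) τ-at-i)

  σ-at-j : ∀ A → lookup (σ A) j ≡ lookup A i
  σ-at-j A = trans (lookup-relabel (transpose i j) A j) (cong (lookup A) τ-at-j)

  σ-elsewhere : ∀ A {x} → x ≢ i → x ≢ j → lookup (σ A) x ≡ lookup A x
  σ-elsewhere A x≢i x≢j = trans (lookup-relabel (transpose i j) A _) (cong (lookup A) (τ-elsewhere x≢i x≢j))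

  σ-involutive : ∀ A → σ (σ A) ≡ A
  σ-involutive = relabel-involutive (transpose i j) τ-involutive

  ≡σ-by-position : ∀ {A B} → lookup B i ≡ lookup A j → lookup B j ≡ lookup A i →
    (∀ {x} → x ≢ i → x ≢ j → lookup B x ≡ lookup A x) → B ≡ σ A
  ≡σ-by-position {A} {B} atI atJ rest = subset-ext pointwise
    where
    pointwise : ∀ x → lookup B x ≡ lookup (σ A) x
    pointwise x with position i j x
    ... | at-i              = trans atI (sym (σ-at-i A))
    ... | at-j              = trans atJ (sym (σ-at-j A))
    ... | elsewhere x≢i x≢j = trans (rest x≢i x≢j) (sym (σ-elsewhere A x≢i x≢j))

  σ-fixes : ∀ {A} → i ∉ A → j ∉ A → A ≡ σ A
  σ-fixes {A} i∉A j∉A = ≡σ-by-position {A} {A}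
    (trans (∉⇒outside i∉A) (sym (∉⇒outside j∉A)))
    (trans (∉⇒outside j∉A) (sym (∉⇒outside i∉A)))
    (λ _ _ → refl)

  shift-is-σ : i ≢ j → ∀ {A} → j ∈ A → i ∉ A → shift i j A ≡ σ A
  shift-is-σ i≢j {A} j∈A i∉A with j ∈? A | i ∈? A
  ... | no j∉A | _       = contradiction j∈A j∉A
  ... | yes _  | yes i∈A = contradiction i∈A i∉A
  ... | yes _  | no _    = ≡σ-by-position {A} {(A [ j ]≔ outside) [ i ]≔ inside}
    (trans (lookup∘update i (A [ j ]≔ outside) inside) (sym (∈⇒inside j∈A)))
    (begin
      lookup ((A [ j ]≔ outside) [ i ]≔ inside) j ≡⟨ lookup∘update′ (i≢j ∘ sym) (A [ j ]≔ outside) inside ⟩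
      lookup (A [ j ]≔ outside) j                 ≡⟨ lookup∘update j A outside ⟩
      outside                                     ≡⟨ ∉⇒outside i∉A ⟨
      lookup A i                                  ∎)
    (λ x≢i x≢j → trans (lookup∘update′ x≢i (A [ j ]≔ outside) inside) (lookup∘update′ x≢j A outside))

  shift-fixes : ∀ {A} → ¬ (j ∈ A × i ∉ A) → shift i j A ≡ A
  shift-fixes {A} unshiftable with j ∈? A | i ∈? A
  ... | yes j∈A | no i∉A = contradiction (j∈A , i∉A) unshiftable
  ... | yes _   | yes _  = refl
  ... | no _    | _      = refl

  module Classification (𝓕 : Family n) where

    Kept : Subset n → Set
    Kept X = 𝓕 X × (j ∈ X → i ∉ X → 𝓕 (σ X))

    Moved : Subset n → Set
    Moved X = 𝓕 (σ X) × i ∈ X × j ∉ X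

    σ-image-moved : ∀ {B} → 𝓕 B → j ∈ B → i ∉ B → Moved (σ B)
    σ-image-moved {B} B∈𝓕 j∈B i∉B =
      subst 𝓕 (sym (σ-involutive B)) B∈𝓕 ,
      lookup⇒[]= i (σ B) (trans (σ-at-i B) (∈⇒inside j∈B)) ,
      λ j∈σB → i∉B (lookup⇒[]= i B (trans (sym (σ-at-j B)) (∈⇒inside j∈σB)))

    classify : i ≢ j → ∀ {X} → shiftFam i j 𝓕 X → Kept X ⊎ Moved X
    classify i≢j (inj₂ (X∈𝓕 , shiftX∈𝓕)) =
      inj₁ (X∈𝓕 , λ j∈X i∉X → subst 𝓕 (shift-is-σ i≢j j∈X i∉X) shiftX∈𝓕)
    classify i≢j (inj₁ (B , B∈𝓕 , refl)) = byShiftability ((j ∈? B) ×-dec ¬? (i ∈? B))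
      where
      byShiftability : Dec (j ∈ B × i ∉ B) → Kept (shift i j B) ⊎ Moved (shift i j B)
      byShiftability (yes (j∈B , i∉B)) =
        subst (λ X → Kept X ⊎ Moved X) (sym (shift-is-σ i≢j j∈B i∉B)) (inj₂ (σ-image-moved B∈𝓕 j∈B i∉B))
      byShiftability (no unshiftable) =
        subst (λ X → Kept X ⊎ Moved X) (sym (shift-fixes unshiftable))
              (inj₁ (B∈𝓕 , λ j∈B i∉B → contradiction (j∈B , i∉B) unshiftable))

    σ-into-𝓕 : ∀ {s} (G : Fin s → Subset n) → (∀ a → Kept (G a) ⊎ Moved (G a)) →
      (∀ a b → ¬ a ≡ b → G a ∩ G b ≡ ⊥) → ∀ a₀ → Moved (G a₀) → ∀ a → 𝓕 (σ (G a))
    σ-into-𝓕 G kind disjoint a₀ (σGa₀∈𝓕 , i∈Ga₀ , _) a with a ≟ a₀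
    ... | yes refl = σGa₀∈𝓕
    ... | no a≢a₀  = fromKind (kind a) (disjoint⇒∉ (disjoint a₀ a (a≢a₀ ∘ sym)) i∈Ga₀)
      where
      fromKind : Kept (G a) ⊎ Moved (G a) → i ∉ G a → 𝓕 (σ (G a))
      fromKind (inj₂ (σGa∈𝓕 , _)) _ = σGa∈𝓕
      fromKind (inj₁ (Ga∈𝓕 , shiftable)) i∉Ga with j ∈? G a
      ... | yes j∈Ga = shiftable j∈Ga i∉Ga
      ... | no j∉Ga  = subst 𝓕 (σ-fixes i∉Ga j∉Ga) Ga∈𝓕

-- Theorem: S_{i,j} preserves D(s,q).
mainTheorem11 : (n s : ℕ) (q : ℤ) → 1 ≤ n → 2 ≤ s → (𝓕 : Family n) → D s q 𝓕 →
    (i j : Fin n) → i <ᶠ j → D s q (shiftFam i j 𝓕)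
mainTheorem11 n s q _ _ 𝓕 D𝓕 i j i<j G member disjoint = conclude (allOrSome kind)
  where
  open Swap i j
  open Classification 𝓕

  kind : ∀ a → Kept (G a) ⊎ Moved (G a)
  kind a = classify (<⇒≢ i<j) (member a)

  conclude : (∀ a → Kept (G a)) ⊎ ∃ (Moved ∘ G) → q < + ∣ ⋃ᶠ G ∣
  conclude (inj₁ allKept)       = D𝓕 G (proj₁ ∘ allKept) disjoint
  conclude (inj₂ (a₀ , moved₀)) =
    relabel-D (transpose i j) 𝓕 D𝓕 G (σ-into-𝓕 G kind disjoint a₀ moved₀) disjoint
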